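{- For integers $n\ge m\ge 4$ and $0\le g\le \lfloor n/2\rfloor-1$, $$n+m-2+g\le t^{g}(K_n\square K_m)\le (g+1)(m-1)+n-1.$$ Moreover, the bounds are sharp.
   Context: $K_n$ is the complete graph on $n$ vertices and $\square$ the Cartesian product. For a graph $\Gamma=(V,E)$ and $F\subseteq V$, $F$ is a $g$-good-neighbor conditional faulty set if every vertex of $V\setminus F$ has at least $g$ neighbors in $V\setminus F$. PMC model: distinct $F_1,F_2\subseteq V$ are distinguishable iff there exist $u\in F_1\triangle F_2$, $v\in V\setminus(F_1\cup F_2)$ with $uv\in E$. $t^g(\Gamma)$ is the maximum $t$ such that every pair of distinct $g$-good-neighbor conditional faulty sets of size at most $t$ is distinguishable. -}

module Defs where

open import Data.Bool using (Bool; true; false; not; _∧_; _∨_; _xor_)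
open import Data.Nat using (ℕ; _≤_)
open import Data.Fin using (Fin; _≟_)
open import Data.List using (List; length; filter; cartesianProduct; allFin)
open import Data.List.Membership.Propositional using (_∈_)
open import Data.List.Membership.Propositional.Properties
  using (∈-allFin; ∈-cartesianProduct⁺)
open import Data.List.Relation.Unary.Unique.Propositional using (Unique)
open import Data.List.Relation.Unary.Unique.Propositional.Properties
  using (allFin⁺; cartesianProduct⁺)
open import Data.Product using (_×_; _,_; ∃-syntax)
open import Data.Product.Properties using (≡-dec)
open import Relation.Binary.PropositionalEquality using (_≡_; _≢_)
open import Relation.Nullary.Decidable using (⌊_⌋; T?)
open import Relation.Binary.Definitions using (DecidableEquality)

record Graph : Set₁ where
  field
    V              : Set
    _≟V_           : DecidableEquality V
    verts          : List V
    verts-complete : ∀ v → v ∈ verts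
    verts-unique   : Unique verts
    adj            : V → V → Bool

open Graph public

K : ℕ → Graph
K k = record
  { V = Fin k
  ; _≟V_ = _≟_
  ; verts = allFin k
  ; verts-complete = ∈-allFin
  ; verts-unique = allFin⁺ k
  ; adj = λ a b → not ⌊ a ≟ b ⌋
  }

_□_ : Graph → Graph → Graph
G □ H = record
  { V = V G × V H
  ; _≟V_ = ≡-dec (_≟V_ G) (_≟V_ H)
  ; verts = cartesianProduct (verts G) (verts H)
  ; verts-complete = λ { (a , b) → ∈-cartesianProduct⁺ (verts-complete G a) (verts-complete H b) }
  ; verts-unique = cartesianProduct⁺ (verts-unique G) (verts-unique H)
  ; adj = λ { (a , b) (c , d) →
        (⌊ _≟V_ G a c ⌋ ∧ adj H b d) ∨ (adj G a c ∧ ⌊ _≟V_ H b d ⌋) }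
  }

VSet : Graph → Set
VSet Γ = V Γ → Bool

∣_∣ₛ : {Γ : Graph} → VSet Γ → ℕ
∣_∣ₛ {Γ} F = length (filter (λ v → T? (F v)) (verts Γ))

outNbrs : (Γ : Graph) → VSet Γ → V Γ → ℕ
outNbrs Γ F v = length (filter (λ w → T? (adj Γ v w ∧ not (F w))) (verts Γ))

GoodNbr : (Γ : Graph) → ℕ → VSet Γ → Set
GoodNbr Γ g F = ∀ v → F v ≡ false → g ≤ outNbrs Γ F v

Distinct : (Γ : Graph) → VSet Γ → VSet Γ → Set
Distinct Γ F₁ F₂ = ∃[ v ] F₁ v ≢ F₂ v

Distinguishable : (Γ : Graph) → VSet Γ → VSet Γ → Set
Distinguishable Γ F₁ F₂ =
  ∃[ u ] ∃[ v ] ((F₁ u xor F₂ u) ≡ true × (F₁ v ∨ F₂ v) ≡ false × adj Γ u v ≡ true)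

Diagnosable : (Γ : Graph) → ℕ → ℕ → Set
Diagnosable Γ g t = ∀ (F₁ F₂ : VSet Γ) →
  GoodNbr Γ g F₁ → GoodNbr Γ g F₂ → ∣_∣ₛ {Γ} F₁ ≤ t → ∣_∣ₛ {Γ} F₂ ≤ t →
  Distinct Γ F₁ F₂ → Distinguishable Γ F₁ F₂

IsTg : (Γ : Graph) → ℕ → ℕ → Set
IsTg Γ g t = Diagnosable Γ g t × (∀ t′ → Diagnosable Γ g t′ → t′ ≤ t)

-- In K n □ K m the neighbours of (a , b) are the other n + m − 2 vertices of its row and column.
--
-- Let F₁ ≠ F₂ be indistinguishable g-good sets and y = (a , b) ∈ F₂ ∖ F₁.  No vertex
-- of F₁ △ F₂ is adjacent to a vertex outside F₁ ∪ F₂.  So if some u = (c , e) lies outside F₁ ∪ F₂,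
-- then for every path y – x – w with w equal or adjacent to u, x or w lies in F₁ ∩ F₂: every column
-- meets F₁ ∩ F₂ in row a or row c, and every other row meets it in column b or e, which gives
-- ∣F₁ ∩ F₂∣ ≥ n + m − 2.  As y and its ≥ g neighbours outside F₁ lie in F₂ ∖ F₁, this makes
-- ∣F₂∣ ≥ n + m − 1 + g.  Otherwise F₁ ∪ F₂ covers all n m > 2 (n + m − 2 + g) vertices.
--
-- Upper bound.  F₂ = (first g + 1 rows) ∪ (first column) and F₁ = F₂ minus the corner block where
-- they meet are g-good, have at most (g + 1)(m − 1) + n elements and are indistinguishable.
--
-- Diagnosability is decidable (there are finitely many vertex sets) and antitone in t, so t^g
-- exists and lies between the two bounds, which coincide for n = m = 4 and g = 0.

module Submission where

open import Defs
open import Data.Bool using (Bool; true; false; not; _∧_; _∨_; _xor_; if_then_else_)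
open import Data.Bool.Properties
  using (T-≡; xor-comm; ∨-comm; ∨-zeroʳ; ∨-identityʳ; ∨-conicalʳ; ¬-not) renaming (_≟_ to _≟ᵇ_)
open import Data.Empty using (⊥-elim)
open import Data.Fin using (Fin; zero; suc; toℕ; _≟_)
open import Data.List
  using (List; []; _∷_; _++_; length; map; filterᵇ; cartesianProduct; cartesianProductWith; allFin)
open import Data.List.Properties using (length-map; length-++-sucʳ; length-tabulate; map-tabulate)
open import Data.List.Membership.Propositional using (_∈_)
open import Data.List.Membership.Propositional.Properties
  using (∈-∃++; ∈-map⁺; ∈-filter⁺; ∈-filter⁻; ∈-cartesianProductWith⁺)
open import Data.List.Relation.Binary.Subset.Propositional using (_⊆_)
import Data.List.Relation.Unary.All as All
open import Data.List.Relation.Unary.AllPairs using (_∷_)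
open import Data.List.Relation.Unary.Any using (here; there; any?)
import Data.List.Relation.Unary.Any as Any
open import Data.List.Relation.Unary.Unique.Propositional using (Unique)
import Data.List.Relation.Unary.Unique.Propositional.Properties as Unique
open import Data.Nat using (ℕ; zero; suc; _+_; _*_; _∸_; _≤_; _<_; _≤?_; _<ᵇ_; z≤n; s≤s; >-nonZero)
open import Data.Nat.DivMod using (_/_; m/n*n≤m; m≥n⇒m/n>0)
open import Data.Nat.Properties hiding (_≟_)
open import Data.Nat.Tactic.RingSolver using (solve-∀)
open import Data.Product using (_×_; _,_; proj₁; proj₂; ∃-syntax)
open import Data.Sum using (_⊎_; inj₁; inj₂)
open import Function using (_∘_; Equivalence)
open import Relation.Binary.Definitions using (DecidableEquality)
open import Relation.Binary.PropositionalEquality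
open import Relation.Nullary using (¬_; contradiction)
open import Relation.Nullary.Decidable
  using (Dec; ⌊_⌋; T?; yes; no; map′; ¬?; _×-dec_; _→-dec_; dec-true; dec-false; isYes≗does)

private variable
  A B : Set
  p q : A → Bool
  n : ℕ

isYes-true : {P : Set} (P? : Dec P) → P → ⌊ P? ⌋ ≡ true
isYes-true P? p = trans (isYes≗does P?) (dec-true P? p)

isYes-false : {P : Set} (P? : Dec P) → ¬ P → ⌊ P? ⌋ ≡ false
isYes-false P? ¬p = trans (isYes≗does P?) (dec-false P? ¬p)

∧-trueˡ : ∀ x {y} → (x ∧ y) ≡ true → x ≡ true
∧-trueˡ true _ = refl

none⊎one⊎both : ∀ x y → (x ∨ y) ≡ false ⊎ (x xor y) ≡ true ⊎ (x ∧ y) ≡ true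
none⊎one⊎both false false = inj₁ refl
none⊎one⊎both false true  = inj₂ (inj₁ refl)
none⊎one⊎both true  false = inj₂ (inj₁ refl)
none⊎one⊎both true  true  = inj₂ (inj₂ refl)

-- Counting

-- With xs = verts Γ this is definitionally ∣_∣ₛ, and outNbrs is a count too.
count : (A → Bool) → List A → ℕ
count p xs = length (filterᵇ p xs)

count-mono : (∀ x → p x ≡ true → q x ≡ true) → (xs : List A) → count p xs ≤ count q xs
count-mono p⇒q [] = z≤n
count-mono {p = p} {q} p⇒q (x ∷ xs) with p x in px | q x in qx
... | true  | true  = s≤s (count-mono p⇒q xs)
... | true  | false = contradiction (trans (sym (p⇒q x px)) qx) λ ()
... | false | true  = m≤n⇒m≤1+n (count-mono p⇒q xs)
... | false | false = count-mono p⇒q xs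

count-cong : p ≗ q → (xs : List A) → count p xs ≡ count q xs
count-cong p≗q xs = ≤-antisym (count-mono (λ x px → trans (sym (p≗q x)) px) xs)
                              (count-mono (λ x qx → trans (p≗q x) qx) xs)

count-split : (s : A → Bool) (p : A → Bool) (xs : List A) →
              count (λ x → s x ∧ p x) xs + count (λ x → not (s x) ∧ p x) xs ≡ count p xs
count-split s p [] = refl
count-split s p (x ∷ xs) with s x | p x
... | true  | true  = cong suc (count-split s p xs)
... | true  | false = count-split s p xs
... | false | true  = trans (+-suc _ _) (cong suc (count-split s p xs))
... | false | false = count-split s p xs

count-∨ : (∀ x → p x ≡ true → q x ≡ false) → (xs : List A) →
          count (λ x → p x ∨ q x) xs ≡ count p xs + count q xs
count-∨ disj [] = refl
count-∨ {p = p} {q} disj (x ∷ xs) with p x in px | q x in qx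
... | true  | true  = contradiction (trans (sym (disj x px)) qx) λ ()
... | true  | false = cong suc (count-∨ disj xs)
... | false | true  = trans (cong suc (count-∨ disj xs)) (sym (+-suc _ _))
... | false | false = count-∨ disj xs

count-true : (xs : List A) → count (λ _ → true) xs ≡ length xs
count-true []       = refl
count-true (x ∷ xs) = cong suc (count-true xs)

count-complement : (p : A → Bool) (xs : List A) → count p xs + count (not ∘ p) xs ≡ length xs
count-complement p [] = refl
count-complement p (x ∷ xs) with p x
... | true  = cong suc (count-complement p xs)
... | false = trans (+-suc _ _) (cong suc (count-complement p xs))

count-∨-≤ : (p q : A → Bool) (xs : List A) → count (λ x → p x ∨ q x) xs ≤ count p xs + count q xs
count-∨-≤ p q [] = z≤n
count-∨-≤ p q (x ∷ xs) with p x | q x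
... | true  | true  = s≤s (≤-trans (count-∨-≤ p q xs) (+-monoʳ-≤ (count p xs) (n≤1+n _)))
... | true  | false = s≤s (count-∨-≤ p q xs)
... | false | true  = ≤-trans (s≤s (count-∨-≤ p q xs)) (≤-reflexive (sym (+-suc _ _)))
... | false | false = count-∨-≤ p q xs

count-∈ : (p : A → Bool) {x : A} {xs : List A} → x ∈ xs → p x ≡ true → 1 ≤ count p xs
count-∈ p (here refl) px rewrite px = s≤s z≤n
count-∈ p {xs = y ∷ _} (there x∈) px with p y
... | true  = s≤s z≤n
... | false = count-∈ p x∈ px

count-map : (p : B → Bool) (f : A → B) (xs : List A) → count p (map f xs) ≡ count (p ∘ f) xs
count-map p f [] = refl
count-map p f (x ∷ xs) with p (f x)
... | true  = cong suc (count-map p f xs)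
... | false = count-map p f xs

count-false : (xs : List A) → count (λ _ → false) xs ≡ 0
count-false []       = refl
count-false (x ∷ xs) = count-false xs

count-++ : (p : A → Bool) (xs ys : List A) → count p (xs ++ ys) ≡ count p xs + count p ys
count-++ p [] ys = refl
count-++ p (x ∷ xs) ys with p x
... | true  = cong suc (count-++ p xs ys)
... | false = count-++ p xs ys

count-× : (p : A → Bool) (q : B → Bool) (xs : List A) (ys : List B) →
          count (λ w → p (proj₁ w) ∧ q (proj₂ w)) (cartesianProduct xs ys) ≡ count p xs * count q ys
count-× p q [] ys = refl
count-× p q (x ∷ xs) ys = begin
  count P (map (x ,_) ys ++ cartesianProduct xs ys)           ≡⟨ count-++ P (map (x ,_) ys) _ ⟩
  count P (map (x ,_) ys) + count P (cartesianProduct xs ys)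
    ≡⟨ cong₂ _+_ (count-map P (x ,_) ys) (count-× p q xs ys) ⟩
  count (λ y → p x ∧ q y) ys + count p xs * count q ys        ≡⟨ row ⟩
  count p (x ∷ xs) * count q ys                               ∎
  where
  open ≡-Reasoning
  P : _ → Bool
  P w = p (proj₁ w) ∧ q (proj₂ w)
  row : count (λ y → p x ∧ q y) ys + count p xs * count q ys ≡ count p (x ∷ xs) * count q ys
  row with p x
  ... | true  = refl
  ... | false = cong (_+ count p xs * count q ys) (count-false ys)

∈-++-skip : {x w : A} (ys zs : List A) → w ∈ ys ++ x ∷ zs → w ≢ x → w ∈ ys ++ zs
∈-++-skip []       zs (here refl) w≢x = contradiction refl w≢x
∈-++-skip []       zs (there w∈)  _   = w∈
∈-++-skip (y ∷ ys) zs (here refl) _   = here refl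
∈-++-skip (y ∷ ys) zs (there w∈)  w≢x = there (∈-++-skip ys zs w∈ w≢x)

length-mono-⊆ : {xs ys : List A} → Unique xs → xs ⊆ ys → length xs ≤ length ys
length-mono-⊆ {xs = []} _ _ = z≤n
length-mono-⊆ {xs = x ∷ xs} (x∉xs ∷ xs!) xs⊆ys
  with ys₁ , ys₂ , refl ← ∈-∃++ (xs⊆ys (here refl)) =
  ≤-trans (s≤s (length-mono-⊆ xs! xs⊆ys₁++ys₂)) (≤-reflexive (sym (length-++-sucʳ ys₁ x ys₂)))
  where
  xs⊆ys₁++ys₂ : xs ⊆ ys₁ ++ ys₂
  xs⊆ys₁++ys₂ w∈ = ∈-++-skip ys₁ ys₂ (xs⊆ys (there w∈)) (All.lookup x∉xs w∈ ∘ sym)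

count-≤-onto : {xs : List A} {ys : List B} (p : A → Bool) (q : B → Bool) (r : B → A) →
               Unique xs →
               (∀ {x} → x ∈ xs → p x ≡ true → ∃[ y ] y ∈ ys × q y ≡ true × r y ≡ x) →
               count p xs ≤ count q ys
count-≤-onto {xs = xs} {ys = ys} p q r xs! onto = begin
  length (filterᵇ p xs)         ≤⟨ length-mono-⊆ (Unique.filter⁺ (T? ∘ p) xs!) covered ⟩
  length (map r (filterᵇ q ys)) ≡⟨ length-map r (filterᵇ q ys) ⟩
  length (filterᵇ q ys)         ∎
  where
  open ≤-Reasoning
  covered : filterᵇ p xs ⊆ map r (filterᵇ q ys)
  covered x∈ with x∈xs , px ← ∈-filter⁻ (T? ∘ p) x∈
             with y , y∈ys , qy , refl ← onto x∈xs (Equivalence.to T-≡ px) =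
    ∈-map⁺ r (∈-filter⁺ (T? ∘ q) y∈ys (Equivalence.from T-≡ qy))

length-allFin : (n : ℕ) → length (allFin n) ≡ n
length-allFin n = length-tabulate {n = n} (λ i → i)

count-true-allFin : (n : ℕ) → count (λ _ → true) (allFin n) ≡ n
count-true-allFin n = trans (count-true (allFin n)) (length-allFin n)

allFin-suc : (n : ℕ) → allFin (suc n) ≡ zero ∷ map suc (allFin n)
allFin-suc n = cong (zero ∷_) (sym (map-tabulate (λ i → i) suc))

count-allFin-suc : (p : Fin (suc n) → Bool) →
                   count p (allFin (suc n)) ≡ count p (zero ∷ []) + count (p ∘ suc) (allFin n)
count-allFin-suc {n} p = begin
  count p (allFin (suc n))                            ≡⟨ cong (count p) (allFin-suc n) ⟩
  count p (zero ∷ map suc (allFin n))                 ≡⟨ count-++ p (zero ∷ []) (map suc (allFin n)) ⟩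
  count p (zero ∷ []) + count p (map suc (allFin n))  ≡⟨ cong (count p (zero ∷ []) +_) (count-map p suc (allFin n)) ⟩
  count p (zero ∷ []) + count (p ∘ suc) (allFin n)    ∎
  where open ≡-Reasoning

count-≟-allFin : (i : Fin n) → count (λ c → ⌊ i ≟ c ⌋) (allFin n) ≡ 1
count-≟-allFin {suc n} zero    =
  trans (count-allFin-suc {n} (λ c → ⌊ zero ≟ c ⌋)) (cong suc (count-false (allFin n)))
count-≟-allFin {suc n} (suc i) =
  trans (count-allFin-suc {n} (λ c → ⌊ suc i ≟ c ⌋))
        (trans (count-cong ≟-suc (allFin n)) (count-≟-allFin i))
  where
  ≟-suc : (c : Fin n) → ⌊ suc i ≟ suc c ⌋ ≡ ⌊ i ≟ c ⌋
  ≟-suc c with i ≟ c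
  ... | yes _ = refl
  ... | no  _ = refl

count-<ᵇ-allFin : {k : ℕ} → k ≤ n → count (λ a → toℕ a <ᵇ k) (allFin n) ≡ k
count-<ᵇ-allFin {n} {zero} _ = count-false (allFin n)
count-<ᵇ-allFin {suc n} {suc k} (s≤s k≤n) =
  trans (count-allFin-suc {n} (λ a → toℕ a <ᵇ suc k)) (cong suc (count-<ᵇ-allFin k≤n))

count-not-<ᵇ-allFin : {k : ℕ} → k ≤ n → count (not ∘ (λ a → toℕ a <ᵇ k)) (allFin n) ≡ n ∸ k
count-not-<ᵇ-allFin {n} {k} k≤n = begin
  X                                            ≡⟨ sym (m+n∸m≡n k X) ⟩
  k + X ∸ k                                    ≡⟨ cong (λ i → i + X ∸ k) (sym (count-<ᵇ-allFin k≤n)) ⟩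
  count (λ a → toℕ a <ᵇ k) (allFin n) + X ∸ k  ≡⟨ cong (_∸ k) (count-complement _ (allFin n)) ⟩
  length (allFin n) ∸ k                        ≡⟨ cong (_∸ k) (length-allFin n) ⟩
  n ∸ k                                        ∎
  where
  open ≡-Reasoning
  X = count (not ∘ (λ a → toℕ a <ᵇ k)) (allFin n)

count-≢ : (a : Fin n) (p : Fin n → Bool) →
          count p (allFin n) ≤ suc (count (λ c → not ⌊ a ≟ c ⌋ ∧ p c) (allFin n))
count-≢ {n} a p = begin
  count p (allFin n)          ≡⟨ sym (count-split (λ c → ⌊ a ≟ c ⌋) p (allFin n)) ⟩
  count a∧p (allFin n) + R    ≤⟨ +-monoˡ-≤ R (count-mono (λ c → ∧-trueˡ _) (allFin n)) ⟩
  count a≟ (allFin n) + R     ≡⟨ cong (_+ R) (count-≟-allFin a) ⟩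
  suc R                       ∎
  where
  open ≤-Reasoning
  a≟ a∧p : Fin n → Bool
  a≟  c = ⌊ a ≟ c ⌋
  a∧p c = ⌊ a ≟ c ⌋ ∧ p c
  R = count (λ c → not ⌊ a ≟ c ⌋ ∧ p c) (allFin n)

-- Deciding diagnosability

module _ {P : A → Set} {xs : List A} (complete : ∀ x → x ∈ xs) where

  ∀-dec : (∀ x → Dec (P x)) → Dec (∀ x → P x)
  ∀-dec P? = map′ (λ all x → All.lookup all (complete x)) (λ ∀P → All.tabulate (λ {x} _ → ∀P x))
                  (All.all? P? xs)

  ∃-dec : (∀ x → Dec (P x)) → Dec (∃[ x ] P x)
  ∃-dec P? = map′ Any.satisfied (λ (x , px) → Any.map (λ { refl → px }) (complete x)) (any? P? xs)

module Subsets (_≟ₐ_ : DecidableEquality A) where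

  update : A → Bool → (A → Bool) → A → Bool
  update x b F y = if ⌊ y ≟ₐ x ⌋ then b else F y

  subsets : List A → List (A → Bool)
  subsets []       = (λ _ → false) ∷ []
  subsets (x ∷ xs) = cartesianProductWith (update x) (true ∷ false ∷ []) (subsets xs)

  subsets-complete : (F : A → Bool) (xs : List A) →
                     ∃[ F′ ] F′ ∈ subsets xs × (∀ {x} → x ∈ xs → F x ≡ F′ x)
  subsets-complete F [] = _ , here refl , λ ()
  subsets-complete F (x ∷ xs) with F′ , F′∈ , agree ← subsets-complete F xs =
    update x (F x) F′ , ∈-cartesianProductWith⁺ (update x) (bool∈ (F x)) F′∈ , agree′
    where
    bool∈ : ∀ b → b ∈ true ∷ false ∷ []
    bool∈ true  = here refl
    bool∈ false = there (here refl)
    agree′ : ∀ {y} → y ∈ x ∷ xs → F y ≡ update x (F x) F′ y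
    agree′ {y} y∈ with y ≟ₐ x
    agree′ _          | yes refl = refl
    agree′ (here y≡x) | no  y≢x  = contradiction y≡x y≢x
    agree′ (there y∈) | no  _    = agree y∈

module _ (Γ : Graph) where

  open Subsets (_≟V_ Γ) using (subsets; subsets-complete)

  -- Without function extensionality, P has to respect pointwise equality.
  ∀-VSet-dec : {P : VSet Γ → Set} → (∀ {F F′} → F ≗ F′ → P F′ → P F) → (∀ F → Dec (P F)) →
               Dec (∀ F → P F)
  ∀-VSet-dec resp P? =
    map′ (λ all F → let F′ , F′∈ , agree = subsets-complete F (verts Γ)
                    in resp (λ v → agree (verts-complete Γ v)) (All.lookup all F′∈))
         (λ ∀P → All.tabulate (λ {F} _ → ∀P F))
         (All.all? P? (subsets (verts Γ)))

  GoodNbr? : ∀ g F → Dec (GoodNbr Γ g F)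
  GoodNbr? g F = ∀-dec (verts-complete Γ) (λ v → (F v ≟ᵇ false) →-dec (g ≤? outNbrs Γ F v))

  Distinct? : ∀ F₁ F₂ → Dec (Distinct Γ F₁ F₂)
  Distinct? F₁ F₂ = ∃-dec (verts-complete Γ) (λ v → ¬? (F₁ v ≟ᵇ F₂ v))

  Distinguishable? : ∀ F₁ F₂ → Dec (Distinguishable Γ F₁ F₂)
  Distinguishable? F₁ F₂ = ∃-dec (verts-complete Γ) λ u → ∃-dec (verts-complete Γ) λ v →
    ((F₁ u xor F₂ u) ≟ᵇ true) ×-dec ((F₁ v ∨ F₂ v) ≟ᵇ false) ×-dec (adj Γ u v ≟ᵇ true)

  PairDiagnosable : ℕ → ℕ → VSet Γ → VSet Γ → Set
  PairDiagnosable g t F₁ F₂ =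
    GoodNbr Γ g F₁ → GoodNbr Γ g F₂ → ∣_∣ₛ {Γ} F₁ ≤ t → ∣_∣ₛ {Γ} F₂ ≤ t →
    Distinct Γ F₁ F₂ → Distinguishable Γ F₁ F₂

  PairDiagnosable? : ∀ g t F₁ F₂ → Dec (PairDiagnosable g t F₁ F₂)
  PairDiagnosable? g t F₁ F₂ =
    GoodNbr? g F₁ →-dec GoodNbr? g F₂ →-dec (_ ≤? t) →-dec (_ ≤? t) →-dec
    Distinct? F₁ F₂ →-dec Distinguishable? F₁ F₂

  GoodNbr-resp : ∀ {g F F′} → F ≗ F′ → GoodNbr Γ g F → GoodNbr Γ g F′
  GoodNbr-resp {g} F≗F′ good v F′v =
    subst (g ≤_) (count-cong (λ w → cong (λ b → adj Γ v w ∧ not b) (F≗F′ w)) (verts Γ))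
          (good v (trans (F≗F′ v) F′v))

  PairDiagnosable-resp : ∀ {g t F₁ F₁′ F₂ F₂′} → F₁ ≗ F₁′ → F₂ ≗ F₂′ →
                         PairDiagnosable g t F₁′ F₂′ → PairDiagnosable g t F₁ F₂
  PairDiagnosable-resp {t = t} F₁≗ F₂≗ D good₁ good₂ ∣F₁∣≤t ∣F₂∣≤t (v , F₁v≢F₂v)
    with u , w , u∈△ , w∉∪ , uw ← D (GoodNbr-resp F₁≗ good₁) (GoodNbr-resp F₂≗ good₂)
                                    (subst (_≤ t) (count-cong F₁≗ (verts Γ)) ∣F₁∣≤t)
                                    (subst (_≤ t) (count-cong F₂≗ (verts Γ)) ∣F₂∣≤t)
                                    (v , λ eq → F₁v≢F₂v (trans (F₁≗ v) (trans eq (sym (F₂≗ v))))) =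
    u , w , trans (cong₂ _xor_ (F₁≗ u) (F₂≗ u)) u∈△ , trans (cong₂ _∨_ (F₁≗ w) (F₂≗ w)) w∉∪ , uw

  Diagnosable? : ∀ g t → Dec (Diagnosable Γ g t)
  Diagnosable? g t =
    ∀-VSet-dec (λ F₁≗ D F₂ → PairDiagnosable-resp F₁≗ (λ _ → refl) (D F₂)) λ F₁ →
    ∀-VSet-dec (λ F₂≗ → PairDiagnosable-resp (λ _ → refl) F₂≗) λ F₂ →
    PairDiagnosable? g t F₁ F₂

Diagnosable-anti : ∀ {Γ g s t} → s ≤ t → Diagnosable Γ g t → Diagnosable Γ g s
Diagnosable-anti s≤t D F₁ F₂ good₁ good₂ ∣F₁∣≤s ∣F₂∣≤s =
  D F₁ F₂ good₁ good₂ (≤-trans ∣F₁∣≤s s≤t) (≤-trans ∣F₂∣≤s s≤t)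

module _ {P : ℕ → Set} (P? : ∀ t → Dec (P t)) where

  greatest : ∀ {t₀} u → P t₀ → (∀ t → P t → t ≤ u) → ∃[ t ] (P t × ∀ t′ → P t′ → t′ ≤ t)
  greatest zero P[t₀] bound = 0 , subst P (n≤0⇒n≡0 (bound _ P[t₀])) P[t₀] , bound
  greatest (suc u) P[t₀] bound with P? (suc u)
  ... | yes P[1+u] = suc u , P[1+u] , bound
  ... | no ¬P[1+u] =
    greatest u P[t₀] λ t Pt → m<1+n⇒m≤n (≤∧≢⇒< (bound t Pt) λ { refl → ¬P[1+u] Pt })

Diagnosable-bounded : ∀ {Γ g u} → ¬ Diagnosable Γ g (suc u) → ∀ t → Diagnosable Γ g t → t ≤ u
Diagnosable-bounded {Γ} ¬D[1+u] t D[t] = ≮⇒≥ (λ u<t → ¬D[1+u] (Diagnosable-anti {Γ} u<t D[t]))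

IsTg-between : ∀ {Γ g l u} → Diagnosable Γ g l → ¬ Diagnosable Γ g (suc u) →
               ∃[ t ] (IsTg Γ g t × l ≤ t × t ≤ u)
IsTg-between {Γ} {g} {l} {u} D[l] ¬D[1+u]
  with t , D[t] , maximal ← greatest (Diagnosable? Γ g) u D[l] (Diagnosable-bounded {Γ} ¬D[1+u]) =
  t , (D[t] , maximal) , maximal l D[l] , Diagnosable-bounded {Γ} ¬D[1+u] t D[t]

-- Indistinguishable fault sets

Distinguishable-sym : ∀ {Γ F₁ F₂} → Distinguishable Γ F₁ F₂ → Distinguishable Γ F₂ F₁
Distinguishable-sym {F₁ = F₁} {F₂} (u , v , u∈△ , v∉∪ , uv) =
  u , v , trans (xor-comm (F₂ u) (F₁ u)) u∈△ , trans (∨-comm (F₂ v) (F₁ v)) v∉∪ , uv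

Near : (Γ : Graph) → V Γ → V Γ → Set
Near Γ x y = x ≡ y ⊎ adj Γ x y ≡ true

module Indistinguishable {Γ : Graph} {F₁ F₂ : VSet Γ} (indist : ¬ Distinguishable Γ F₁ F₂) where

  Outside Differ Both : V Γ → Set
  Outside w = (F₁ w ∨ F₂ w) ≡ false
  Differ  w = (F₁ w xor F₂ w) ≡ true
  Both    w = (F₁ w ∧ F₂ w) ≡ true

  differ-not-near-outside : ∀ {x u} → Differ x → Outside u → ¬ Near Γ x u
  differ-not-near-outside {x} x△ u∉ (inj₁ refl) with F₁ x | F₂ x
  differ-not-near-outside () _  (inj₁ refl) | false | false
  differ-not-near-outside _  () (inj₁ refl) | false | true
  differ-not-near-outside _  () (inj₁ refl) | true  | _
  differ-not-near-outside {x} {u} x△ u∉ (inj₂ xu) = indist (x , u , x△ , u∉ , xu)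

  nbr-of-differ : ∀ {x w} → Differ x → adj Γ x w ≡ true → Differ w ⊎ Both w
  nbr-of-differ {x} {w} x△ xw with none⊎one⊎both (F₁ w) (F₂ w)
  ... | inj₁ w∉ = ⊥-elim (indist (x , w , x△ , w∉ , xw))
  ... | inj₂ w△⊎w∈ = w△⊎w∈

  both-or-next : ∀ {u x w} → Outside u → Differ x ⊎ Both x → adj Γ x w ≡ true → Near Γ w u →
                 Both x ⊎ Both w
  both-or-next u∉ (inj₂ x∈) _ _ = inj₁ x∈
  both-or-next u∉ (inj₁ x△) xw wu with nbr-of-differ x△ xw
  ... | inj₁ w△ = ⊥-elim (differ-not-near-outside w△ u∉ wu)
  ... | inj₂ w∈ = inj₂ w∈

  outNbrs<∣F₂∖F₁∣ : ∀ {y} → F₁ y ≡ false → F₂ y ≡ true → adj Γ y y ≡ false →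
                    suc (outNbrs Γ F₁ y) ≤ count (λ w → not (F₁ w) ∧ F₂ w) (verts Γ)
  outNbrs<∣F₂∖F₁∣ {y} F₁y F₂y yy = begin
    suc (outNbrs Γ F₁ y)                                            ≡⟨ +-comm 1 _ ⟩
    outNbrs Γ F₁ y + 1                                              ≤⟨ +-mono-≤ nbrs self ⟩
    count (λ w → adj Γ y w ∧ P w) (verts Γ)
      + count (λ w → not (adj Γ y w) ∧ P w) (verts Γ)               ≡⟨ count-split (adj Γ y) P (verts Γ) ⟩
    count P (verts Γ)                                               ∎
    where
    open ≤-Reasoning
    P : V Γ → Bool
    P w = not (F₁ w) ∧ F₂ w
    y△ : Differ y
    y△ rewrite F₁y | F₂y = refl
    nbr-private : ∀ w → (adj Γ y w ∧ not (F₁ w)) ≡ true → (adj Γ y w ∧ P w) ≡ true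
    nbr-private w _ with adj Γ y w in yw | F₁ w in F₁w | F₂ w in F₂w
    ... | true | false | true  = refl
    ... | true | false | false = ⊥-elim (indist (y , w , y△ , cong₂ _∨_ F₁w F₂w , yw))
    nbr-private w () | true  | true | _
    nbr-private w () | false | _    | _
    nbrs : outNbrs Γ F₁ y ≤ count (λ w → adj Γ y w ∧ P w) (verts Γ)
    nbrs = count-mono nbr-private (verts Γ)
    y-private : (not (adj Γ y y) ∧ P y) ≡ true
    y-private rewrite yy | F₁y | F₂y = refl
    self : 1 ≤ count (λ w → not (adj Γ y w) ∧ P w) (verts Γ)
    self = count-∈ (λ w → not (adj Γ y w) ∧ P w) (verts-complete Γ y) y-private

outNbrs-anti : ∀ {Γ F F′} → (∀ w → F w ≡ true → F′ w ≡ true) →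
               ∀ v → outNbrs Γ F′ v ≤ outNbrs Γ F v
outNbrs-anti {Γ} {F} {F′} F⊆F′ v = count-mono outside-F′ (verts Γ)
  where
  outside-F′ : ∀ w → (adj Γ v w ∧ not (F′ w)) ≡ true → (adj Γ v w ∧ not (F w)) ≡ true
  outside-F′ w _ with adj Γ v w | F w in Fw | F′ w in F′w
  outside-F′ w _  | true  | false | _     = refl
  outside-F′ w _  | true  | true  | false = contradiction (trans (sym (F⊆F′ w Fw)) F′w) λ ()
  outside-F′ w () | true  | true  | true
  outside-F′ w () | false | _     | _

-- The rook's graph K n □ K m

module _ {n m : ℕ} where

  private
    Γ = K n □ K m

  adj-row : ∀ a {b d} → b ≢ d → adj Γ (a , b) (a , d) ≡ true
  adj-row a {b} {d} b≢d rewrite isYes-true (a ≟ a) refl | isYes-false (b ≟ d) b≢d = refl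

  adj-col : ∀ {a c} b → a ≢ c → adj Γ (a , b) (c , b) ≡ true
  adj-col {a} {c} b a≢c rewrite isYes-true (b ≟ b) refl | isYes-false (a ≟ c) a≢c = refl

  adj-irrefl : ∀ v → adj Γ v v ≡ false
  adj-irrefl (a , b) rewrite isYes-true (a ≟ a) refl | isYes-true (b ≟ b) refl = refl

  adj-apart : ∀ {a c b d} → a ≢ c → b ≢ d → adj Γ (a , b) (c , d) ≡ false
  adj-apart {a} {c} {b} {d} a≢c b≢d
    rewrite isYes-false (a ≟ c) a≢c | isYes-false (b ≟ d) b≢d = refl

  near-row : ∀ a b d → Near Γ (a , b) (a , d)
  near-row a b d = near (b ≟ d)
    where
    near : Dec (b ≡ d) → Near Γ (a , b) (a , d)
    near (yes refl) = inj₁ refl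
    near (no  b≢d)  = inj₂ (adj-row a b≢d)

  near-col : ∀ a c b → Near Γ (a , b) (c , b)
  near-col a c b = near (a ≟ c)
    where
    near : Dec (a ≡ c) → Near Γ (a , b) (c , b)
    near (yes refl) = inj₁ refl
    near (no  a≢c)  = inj₂ (adj-col b a≢c)

column-outNbrs : ∀ {n m} (F : VSet (K n □ K m)) a b →
                 count (λ c → not ⌊ a ≟ c ⌋ ∧ not (F (c , b))) (allFin n) ≤ outNbrs (K n □ K m) F (a , b)
column-outNbrs {n} {m} F a b = count-≤-onto _ _ proj₁ (Unique.allFin⁺ n) λ {c} _ → witness c
  where
  witness : ∀ c → (not ⌊ a ≟ c ⌋ ∧ not (F (c , b))) ≡ true →
            ∃[ w ] w ∈ verts (K n □ K m) × (adj (K n □ K m) (a , b) w ∧ not (F w)) ≡ true × proj₁ w ≡ c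
  witness c _   with a ≟ c
  witness c ()  | yes _
  witness c cb∉ | no a≢c =
    (c , b) , verts-complete (K n □ K m) _ , cong₂ _∧_ (adj-col b a≢c) cb∉ , refl

-- The lower bound

module _ {n m : ℕ} {F₁ F₂ : VSet (K n □ K m)} (indist : ¬ Distinguishable (K n □ K m) F₁ F₂) where

  open Indistinguishable {K n □ K m} {F₁} {F₂} indist

  private
    both : VSet (K n □ K m)
    both w = F₁ w ∧ F₂ w

    vs : List (Fin n × Fin m)
    vs = verts (K n □ K m)

  module _ {a b c e} (y△ : Differ (a , b)) (u∉ : Outside (c , e)) where

    private
      a≢c : a ≢ c
      a≢c refl = differ-not-near-outside y△ u∉ (near-row a b e)

      b≢e : b ≢ e
      b≢e refl = differ-not-near-outside y△ u∉ (near-col a c b)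

      rows-meet : ∀ q → Both (a , q) ⊎ Both (c , q)
      rows-meet q = both-or-next u∉ (row-status (q ≟ b)) (adj-col q a≢c) (near-row c q e)
        where
        row-status : Dec (q ≡ b) → Differ (a , q) ⊎ Both (a , q)
        row-status (yes refl) = inj₁ y△
        row-status (no  q≢b)  = nbr-of-differ y△ (adj-row a (q≢b ∘ sym))

      columns-meet : ∀ p → a ≢ p → c ≢ p → Both (p , b) ⊎ Both (p , e)
      columns-meet p a≢p c≢p =
        both-or-next u∉ (nbr-of-differ y△ (adj-col b a≢p)) (adj-row p b≢e)
                     (inj₂ (adj-col e (c≢p ∘ sym)))

      rows-ac : Fin n → Bool
      rows-ac p = ⌊ a ≟ p ⌋ ∨ ⌊ c ≟ p ⌋

      a∈rows-ac : rows-ac a ≡ true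
      a∈rows-ac = cong (_∨ ⌊ c ≟ a ⌋) (isYes-true (a ≟ a) refl)

      c∈rows-ac : rows-ac c ≡ true
      c∈rows-ac = trans (cong (⌊ a ≟ c ⌋ ∨_) (isYes-true (c ≟ c) refl)) (∨-zeroʳ _)

      two-rows : count rows-ac (allFin n) ≡ 2
      two-rows = trans (count-∨ disjoint (allFin n))
                       (cong₂ _+_ (count-≟-allFin a) (count-≟-allFin c))
        where
        disjoint : ∀ p → ⌊ a ≟ p ⌋ ≡ true → ⌊ c ≟ p ⌋ ≡ false
        disjoint p a≟p with a ≟ p
        disjoint p _  | yes refl = isYes-false (c ≟ a) (a≢c ∘ sym)
        disjoint p () | no _

      within-rows : m ≤ count (λ w → rows-ac (proj₁ w) ∧ both w) vs
      within-rows = begin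
        m                                           ≡⟨ sym (count-true-allFin m) ⟩
        count (λ _ → true) (allFin m)               ≤⟨ count-≤-onto (λ _ → true) _ proj₂ (Unique.allFin⁺ m)
                                                         (λ {q} _ _ → witness q (rows-meet q)) ⟩
        count (λ w → rows-ac (proj₁ w) ∧ both w) vs ∎
        where
        open ≤-Reasoning
        witness : ∀ q → Both (a , q) ⊎ Both (c , q) →
                  ∃[ w ] w ∈ vs × (rows-ac (proj₁ w) ∧ both w) ≡ true × proj₂ w ≡ q
        witness q (inj₁ aq∈) = (a , q) , verts-complete (K n □ K m) _ , cong₂ _∧_ a∈rows-ac aq∈ , refl
        witness q (inj₂ cq∈) = (c , q) , verts-complete (K n □ K m) _ , cong₂ _∧_ c∈rows-ac cq∈ , refl

      outside-rows : count (not ∘ rows-ac) (allFin n) ≤ count (λ w → not (rows-ac (proj₁ w)) ∧ both w) vs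
      outside-rows = count-≤-onto (not ∘ rows-ac) _ proj₁ (Unique.allFin⁺ n) λ {p} _ p∉ →
        witness p p∉ (columns-meet p (apart a∈rows-ac p∉) (apart c∈rows-ac p∉))
        where
        apart : ∀ {x p} → rows-ac x ≡ true → not (rows-ac p) ≡ true → x ≢ p
        apart x∈ p∉ refl = contradiction (trans (sym (cong not x∈)) p∉) λ ()
        witness : ∀ p → not (rows-ac p) ≡ true → Both (p , b) ⊎ Both (p , e) →
                  ∃[ w ] w ∈ vs × (not (rows-ac (proj₁ w)) ∧ both w) ≡ true × proj₁ w ≡ p
        witness p p∉ (inj₁ pb∈) = (p , b) , verts-complete (K n □ K m) _ , cong₂ _∧_ p∉ pb∈ , refl
        witness p p∉ (inj₂ pe∈) = (p , e) , verts-complete (K n □ K m) _ , cong₂ _∧_ p∉ pe∈ , refl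

    n+m≤2+∣F₁∩F₂∣ : n + m ≤ 2 + count both vs
    n+m≤2+∣F₁∩F₂∣ = begin
      n + m                                ≡⟨ cong (_+ m) (sym rows-partition) ⟩
      2 + count (not ∘ rows-ac) (allFin n) + m ≤⟨ +-monoʳ-≤ 2 (+-mono-≤ outside-rows within-rows) ⟩
      2 + (outside + inside)               ≡⟨ cong (2 +_) (+-comm outside inside) ⟩
      2 + (inside + outside)               ≡⟨ cong (2 +_) (count-split (rows-ac ∘ proj₁) both vs) ⟩
      2 + count both vs                    ∎
      where
      open ≤-Reasoning
      inside outside : ℕ
      inside  = count (λ w → rows-ac (proj₁ w) ∧ both w) vs
      outside = count (λ w → not (rows-ac (proj₁ w)) ∧ both w) vs
      rows-partition : 2 + count (not ∘ rows-ac) (allFin n) ≡ n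
      rows-partition = begin-equality
        2 + count (not ∘ rows-ac) (allFin n)
          ≡⟨ cong (_+ count (not ∘ rows-ac) (allFin n)) (sym two-rows) ⟩
        count rows-ac (allFin n) + count (not ∘ rows-ac) (allFin n)
          ≡⟨ count-complement rows-ac (allFin n) ⟩
        length (allFin n)
          ≡⟨ length-allFin n ⟩
        n ∎

module _ {n m g : ℕ} {F₁ F₂ : VSet (K n □ K m)} (good₁ : GoodNbr (K n □ K m) g F₁)
         (indist : ¬ Distinguishable (K n □ K m) F₁ F₂) where

  open Indistinguishable {K n □ K m} {F₁} {F₂} indist

  private
    vs : List (Fin n × Fin m)
    vs = verts (K n □ K m)

    vertex-count : count (λ _ → true) vs ≡ n * m
    vertex-count = trans (count-× (λ _ → true) (λ _ → true) (allFin n) (allFin m))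
                         (cong₂ _*_ (count-true-allFin n) (count-true-allFin m))

  indistinguishable-size : ∀ {y} → F₁ y ≡ false → F₂ y ≡ true →
                           n + m + g ≤ suc (∣_∣ₛ {K n □ K m} F₂)
                           ⊎ n * m ≤ ∣_∣ₛ {K n □ K m} F₁ + ∣_∣ₛ {K n □ K m} F₂
  indistinguishable-size {y} F₁y F₂y
    with ∃-dec (verts-complete (K n □ K m)) (λ u → (F₁ u ∨ F₂ u) ≟ᵇ false)
  ... | yes (u , u∉) = inj₁ (begin
    n + m + g                                          ≤⟨ +-monoˡ-≤ g common ⟩
    2 + count both vs + g                              ≡⟨ cong suc (sym (+-suc (count both vs) g)) ⟩
    suc (count both vs + suc g)                        ≤⟨ s≤s (+-monoʳ-≤ (count both vs) private-count) ⟩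
    suc (count both vs + count (λ w → not (F₁ w) ∧ F₂ w) vs) ≡⟨ cong suc (count-split F₁ F₂ vs) ⟩
    suc (count F₂ vs)                                  ∎)
    where
    open ≤-Reasoning
    both : VSet (K n □ K m)
    both w = F₁ w ∧ F₂ w
    y△ : Differ y
    y△ rewrite F₁y | F₂y = refl
    common : n + m ≤ 2 + count both vs
    common = n+m≤2+∣F₁∩F₂∣ {F₁ = F₁} {F₂} indist y△ u∉
    private-count : suc g ≤ count (λ w → not (F₁ w) ∧ F₂ w) vs
    private-count = ≤-trans (s≤s (good₁ y F₁y)) (outNbrs<∣F₂∖F₁∣ F₁y F₂y (adj-irrefl y))
  ... | no ∄u∉ = inj₂ (begin
    n * m                           ≡⟨ sym vertex-count ⟩
    count (λ _ → true) vs           ≤⟨ count-mono (λ w _ → ¬-not (λ w∉ → ∄u∉ (w , w∉))) vs ⟩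
    count (λ w → F₁ w ∨ F₂ w) vs    ≤⟨ count-∨-≤ F₁ F₂ vs ⟩
    count F₁ vs + count F₂ vs       ∎)
    where open ≤-Reasoning

2[n+m∸2+g]<n*m : ∀ {n m g} → 3 ≤ n → 4 ≤ m → 2 * suc g ≤ n → (n + m ∸ 2 + g) + (n + m ∸ 2 + g) < n * m
2[n+m∸2+g]<n*m {suc (suc (suc i))} {suc (suc (suc (suc j)))} {g}
               (s≤s (s≤s (s≤s z≤n))) (s≤s (s≤s (s≤s (s≤s z≤n)))) 2[1+g]≤n = begin
  suc (k + m + g + (k + m + g))               ≡⟨ regroup k m g ⟩
  suc (k + m + (k + m)) + (g + g)             ≤⟨ +-monoʳ-≤ (suc (k + m + (k + m))) g+g≤k ⟩
  suc (k + m + (k + m)) + k                   ≤⟨ m≤m+n _ (i + j + i * j) ⟩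
  suc (k + m + (k + m)) + k + (i + j + i * j) ≡⟨ slack i j ⟩
  (3 + i) * m                                 ∎
  where
  open ≤-Reasoning
  k = suc i
  m = 4 + j
  2*[1+g]≡2+[g+g] : ∀ g → 2 * suc g ≡ 2 + (g + g)
  2*[1+g]≡2+[g+g] = solve-∀
  regroup : ∀ k m g → suc ((k + m + g) + (k + m + g)) ≡ suc ((k + m) + (k + m)) + (g + g)
  regroup = solve-∀
  slack : ∀ i j → suc ((suc i + (4 + j)) + (suc i + (4 + j))) + suc i + (i + j + i * j) ≡
                  (3 + i) * (4 + j)
  slack = solve-∀
  g+g≤k : g + g ≤ k
  g+g≤k = ≤-pred (≤-pred (subst (_≤ 3 + i) (2*[1+g]≡2+[g+g] g) 2[1+g]≤n))

suc[n+m∸2+g]<n+m+g : ∀ {n m g} → 2 ≤ n → suc (n + m ∸ 2 + g) < n + m + g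
suc[n+m∸2+g]<n+m+g (s≤s (s≤s _)) = ≤-refl

indistinguishable-not-both-small :
  ∀ {n m g} {F₁ F₂ : VSet (K n □ K m)} {y} → 3 ≤ n → 4 ≤ m → 2 * suc g ≤ n →
  GoodNbr (K n □ K m) g F₁ → ¬ Distinguishable (K n □ K m) F₁ F₂ → F₁ y ≡ false → F₂ y ≡ true →
  ∣_∣ₛ {K n □ K m} F₁ ≤ n + m ∸ 2 + g → ¬ ∣_∣ₛ {K n □ K m} F₂ ≤ n + m ∸ 2 + g
indistinguishable-not-both-small 3≤n 4≤m 2[1+g]≤n good₁ indist F₁y F₂y ∣F₁∣≤ ∣F₂∣≤
  with indistinguishable-size good₁ indist F₁y F₂y
... | inj₁ large-F₂ =
  <-irrefl refl (≤-trans (suc[n+m∸2+g]<n+m+g (≤-trans (s≤s (s≤s z≤n)) 3≤n))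
                         (≤-trans large-F₂ (s≤s ∣F₂∣≤)))
... | inj₂ covers-all =
  <⇒≱ (2[n+m∸2+g]<n*m 3≤n 4≤m 2[1+g]≤n) (≤-trans covers-all (+-mono-≤ ∣F₁∣≤ ∣F₂∣≤))

diagnosable-lower : ∀ {n m g} → 3 ≤ n → 4 ≤ m → 2 * suc g ≤ n → Diagnosable (K n □ K m) g (n + m ∸ 2 + g)
diagnosable-lower {n} {m} 3≤n 4≤m 2[1+g]≤n F₁ F₂ good₁ good₂ ∣F₁∣≤ ∣F₂∣≤ (v , F₁v≢F₂v)
  with Distinguishable? (K n □ K m) F₁ F₂
... | yes dist = dist
... | no indist with F₁ v in F₁v | F₂ v in F₂v
...   | false | true  =
  ⊥-elim (indistinguishable-not-both-small 3≤n 4≤m 2[1+g]≤n good₁ indist F₁v F₂v ∣F₁∣≤ ∣F₂∣≤)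
...   | true  | false =
  ⊥-elim (indistinguishable-not-both-small 3≤n 4≤m 2[1+g]≤n good₂
           (indist ∘ Distinguishable-sym {K n □ K m} {F₂} {F₁}) F₂v F₁v ∣F₂∣≤ ∣F₁∣≤)
...   | false | false = contradiction refl F₁v≢F₂v
...   | true  | true  = contradiction refl F₁v≢F₂v

-- The upper bound

[1+g]*m+[n∸[1+g]]≡[g+1]*[m∸1]+n : ∀ {n m g} → 1 ≤ m → suc g ≤ n →
                                  suc g * m + (n ∸ suc g) * 1 ≡ (g + 1) * (m ∸ 1) + n
[1+g]*m+[n∸[1+g]]≡[g+1]*[m∸1]+n {n} {suc m} {g} _ 1+g≤n =
  trans (regroup g m (n ∸ suc g)) (cong ((g + 1) * m +_) (m+[n∸m]≡n 1+g≤n))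
  where
  regroup : ∀ g m d → suc g * suc m + d * 1 ≡ (g + 1) * m + (suc g + d)
  regroup = solve-∀

module Construction (n m g : ℕ) (1≤m : 1 ≤ m) (2[1+g]≤n : 2 * suc g ≤ n) where

  private
    Γ = K n □ K m

    1+g≤n : suc g ≤ n
    1+g≤n = ≤-trans (m≤m+n (suc g) _) 2[1+g]≤n

  top-rows : Fin n → Bool
  top-rows a = toℕ a <ᵇ suc g

  first-column : Fin m → Bool
  first-column b = toℕ b <ᵇ 1

  -- F₁ △ F₂ is the corner block top-rows × first-column, all of whose neighbours lie in F₂.
  F₁ F₂ : VSet Γ
  F₁ w = top-rows (proj₁ w) xor first-column (proj₂ w)
  F₂ w = top-rows (proj₁ w) ∨ first-column (proj₂ w)

  F₁⊆F₂ : ∀ w → F₁ w ≡ true → F₂ w ≡ true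
  F₁⊆F₂ w _  with top-rows (proj₁ w) | first-column (proj₂ w)
  F₁⊆F₂ w _  | true  | _     = refl
  F₁⊆F₂ w _  | false | true  = refl
  F₁⊆F₂ w () | false | false

  corner-distinct : ∀ a b → top-rows a ≡ true → first-column b ≡ true → Distinct Γ F₁ F₂
  corner-distinct a b ta fb =
    (a , b) , λ eq → contradiction (trans (sym (cong₂ _xor_ ta fb)) (trans eq (cong₂ _∨_ ta fb))) λ ()

  private
    corner : ∀ x y → ((x xor y) xor (x ∨ y)) ≡ true → x ≡ true × y ≡ true
    corner true  true  _  = refl , refl
    corner true  false ()
    corner false true  ()
    corner false false ()

    outside : ∀ x y → ((x xor y) ∨ (x ∨ y)) ≡ false → x ≡ false × y ≡ false
    outside false false _  = refl , refl
    outside false true  ()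
    outside true  true  ()
    outside true  false ()

  indistinguishable : ¬ Distinguishable Γ F₁ F₂
  indistinguishable ((a , b) , (c , d) , u∈△ , v∉∪ , uv)
    with ta , fb ← corner (top-rows a) (first-column b) u∈△
       | tc , fd ← outside (top-rows c) (first-column d) v∉∪ =
    contradiction (trans (sym uv) (adj-apart {n} {m} {a} {c} {b} {d} a≢c b≢d)) λ ()
    where
    a≢c : a ≢ c
    a≢c refl = contradiction (trans (sym ta) tc) λ ()
    b≢d : b ≢ d
    b≢d refl = contradiction (trans (sym fb) fd) λ ()

  F₂-good : GoodNbr Γ g F₂
  F₂-good (a , b) F₂ab = begin
    g                                                          ≤⟨ ≤-pred (≤-trans 1+g≤rest (count-≢ a _)) ⟩
    count (λ c → not ⌊ a ≟ c ⌋ ∧ not (top-rows c)) (allFin n)  ≡⟨ count-cong same-column (allFin n) ⟩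
    count (λ c → not ⌊ a ≟ c ⌋ ∧ not (F₂ (c , b))) (allFin n)  ≤⟨ column-outNbrs F₂ a b ⟩
    outNbrs Γ F₂ (a , b)                                       ∎
    where
    open ≤-Reasoning
    1+g≤rest : suc g ≤ count (not ∘ top-rows) (allFin n)
    1+g≤rest = subst (suc g ≤_) (sym (count-not-<ᵇ-allFin 1+g≤n))
                     (m+n≤o⇒m≤o∸n (suc g) (subst (_≤ n) (cong (suc g +_) (+-identityʳ _)) 2[1+g]≤n))
    same-column : ∀ c → (not ⌊ a ≟ c ⌋ ∧ not (top-rows c)) ≡ (not ⌊ a ≟ c ⌋ ∧ not (F₂ (c , b)))
    same-column c = cong (λ x → not ⌊ a ≟ c ⌋ ∧ not x)
                         (sym (trans (cong (top-rows c ∨_) (∨-conicalʳ _ _ F₂ab)) (∨-identityʳ _)))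

  F₁-good : GoodNbr Γ g F₁
  F₁-good (a , b) F₁ab with top-rows a in ta | first-column b in fb
  ... | false | false = ≤-trans (F₂-good (a , b) (cong₂ _∨_ ta fb)) (outNbrs-anti {Γ} F₁⊆F₂ (a , b))
  ... | true  | true  = begin
    g                                                          ≤⟨ ≤-pred (≤-trans top-count (count-≢ a top-rows)) ⟩
    count (λ c → not ⌊ a ≟ c ⌋ ∧ top-rows c) (allFin n)        ≡⟨ count-cong same-column (allFin n) ⟩
    count (λ c → not ⌊ a ≟ c ⌋ ∧ not (F₁ (c , b))) (allFin n)  ≤⟨ column-outNbrs F₁ a b ⟩
    outNbrs Γ F₁ (a , b)                                       ∎
    where
    open ≤-Reasoning
    top-count : suc g ≤ count top-rows (allFin n)
    top-count = ≤-reflexive (sym (count-<ᵇ-allFin 1+g≤n))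
    same-column : ∀ c → (not ⌊ a ≟ c ⌋ ∧ top-rows c) ≡ (not ⌊ a ≟ c ⌋ ∧ not (F₁ (c , b)))
    same-column c rewrite fb with top-rows c
    ... | true  = refl
    ... | false = refl
  F₁-good _ () | true  | false
  F₁-good _ () | false | true

  size-F₂ : ∣_∣ₛ {Γ} F₂ ≡ (g + 1) * (m ∸ 1) + n
  size-F₂ = begin
    count F₂ vs                                                   ≡⟨ sym (count-split (top-rows ∘ proj₁) F₂ vs) ⟩
    count (λ w → top-rows (proj₁ w) ∧ F₂ w) vs
      + count (λ w → not (top-rows (proj₁ w)) ∧ F₂ w) vs          ≡⟨ cong₂ _+_ (count-cong top-part vs)
                                                                               (count-cong rest-part vs) ⟩
    count (λ w → top-rows (proj₁ w) ∧ true) vs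
      + count (λ w → not (top-rows (proj₁ w)) ∧ first-column (proj₂ w)) vs
                                                                  ≡⟨ cong₂ _+_ (count-× _ _ (allFin n) (allFin m))
                                                                               (count-× _ _ (allFin n) (allFin m)) ⟩
    count top-rows (allFin n) * count (λ _ → true) (allFin m)
      + count (not ∘ top-rows) (allFin n) * count first-column (allFin m)
                                                                  ≡⟨ cong₂ _+_ (cong₂ _*_ top-count (count-true-allFin m))
                                                                               (cong₂ _*_ rest-count column-count) ⟩
    suc g * m + (n ∸ suc g) * 1                                   ≡⟨ [1+g]*m+[n∸[1+g]]≡[g+1]*[m∸1]+n 1≤m 1+g≤n ⟩
    (g + 1) * (m ∸ 1) + n                                         ∎
    where
    open ≡-Reasoning
    vs = verts Γ
    top-count  = count-<ᵇ-allFin 1+g≤n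
    rest-count = count-not-<ᵇ-allFin 1+g≤n
    column-count = count-<ᵇ-allFin 1≤m
    top-part : ∀ w → (top-rows (proj₁ w) ∧ F₂ w) ≡ (top-rows (proj₁ w) ∧ true)
    top-part w with top-rows (proj₁ w)
    ... | true  = refl
    ... | false = refl
    rest-part : ∀ w → (not (top-rows (proj₁ w)) ∧ F₂ w) ≡ (not (top-rows (proj₁ w)) ∧ first-column (proj₂ w))
    rest-part w with top-rows (proj₁ w)
    ... | true  = refl
    ... | false = refl

not-diagnosable-upper : ∀ {n m g} → 1 ≤ m → 2 * suc g ≤ n → ¬ Diagnosable (K n □ K m) g ((g + 1) * (m ∸ 1) + n)
not-diagnosable-upper {zero} _ ()
not-diagnosable-upper {suc n} {suc m} {g} 1≤m 2[1+g]≤n D =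
  indistinguishable (D F₁ F₂ F₁-good F₂-good ∣F₁∣≤ ∣F₂∣≤ (corner-distinct zero zero refl refl))
  where
  open Construction (suc n) (suc m) g 1≤m 2[1+g]≤n
  ∣F₂∣≤ : ∣_∣ₛ {K (suc n) □ K (suc m)} F₂ ≤ (g + 1) * (suc m ∸ 1) + suc n
  ∣F₂∣≤ = ≤-reflexive size-F₂
  ∣F₁∣≤ : ∣_∣ₛ {K (suc n) □ K (suc m)} F₁ ≤ (g + 1) * (suc m ∸ 1) + suc n
  ∣F₁∣≤ = ≤-trans (count-mono F₁⊆F₂ (verts (K (suc n) □ K (suc m)))) ∣F₂∣≤

g≤n/2∸1⇒2[1+g]≤n : ∀ {n g} → 2 ≤ n → g ≤ n / 2 ∸ 1 → 2 * suc g ≤ n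
g≤n/2∸1⇒2[1+g]≤n {n} {g} 2≤n g≤n/2∸1 = begin
  2 * suc g    ≡⟨ cong (2 *_) (+-comm 1 g) ⟩
  2 * (g + 1)  ≤⟨ *-monoʳ-≤ 2 (m≤o∸n⇒m+n≤o g (m≥n⇒m/n>0 2≤n) g≤n/2∸1) ⟩
  2 * (n / 2)  ≡⟨ *-comm 2 (n / 2) ⟩
  n / 2 * 2    ≤⟨ m/n*n≤m n 2 ⟩
  n            ∎
  where open ≤-Reasoning

tᵍ-bounds : ∀ n m g → 4 ≤ m → m ≤ n → g ≤ n / 2 ∸ 1 →
            ∃[ t ] (IsTg (K n □ K m) g t × n + m ∸ 2 + g ≤ t × t ≤ (g + 1) * (m ∸ 1) + n ∸ 1)
tᵍ-bounds n m g 4≤m m≤n g≤n/2∸1 = IsTg-between {K n □ K m}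
  (diagnosable-lower (≤-trans (s≤s (s≤s (s≤s z≤n))) 4≤n) 4≤m 2[1+g]≤n)
  (subst (λ k → ¬ Diagnosable (K n □ K m) g k) (sym (suc-pred _ {{>-nonZero 0<size}}))
         (not-diagnosable-upper (≤-trans (s≤s z≤n) 4≤m) 2[1+g]≤n))
  where
  4≤n = ≤-trans 4≤m m≤n
  2[1+g]≤n = g≤n/2∸1⇒2[1+g]≤n (≤-trans (s≤s (s≤s z≤n)) 4≤n) g≤n/2∸1
  0<size = ≤-trans (≤-trans (s≤s z≤n) 4≤n) (m≤n+m n ((g + 1) * (m ∸ 1)))

t⁰[K₄□K₄]≡6 : IsTg (K 4 □ K 4) 0 6
t⁰[K₄□K₄]≡6 = let t , isTg , 6≤t , t≤6 = tᵍ-bounds 4 4 0 ≤-refl ≤-refl z≤n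
              in subst (IsTg (K 4 □ K 4) 0) (≤-antisym t≤6 6≤t) isTg

corollary6p3 :
    (∀ (n m g : ℕ) → 4 ≤ m → m ≤ n → g ≤ n / 2 ∸ 1 →
      ∃[ t ] (IsTg (K n □ K m) g t
             × n + m ∸ 2 + g ≤ t
             × t ≤ (g + 1) * (m ∸ 1) + n ∸ 1))
    × (∃[ n ] ∃[ m ] ∃[ g ] (4 ≤ m × m ≤ n × g ≤ n / 2 ∸ 1
             × IsTg (K n □ K m) g (n + m ∸ 2 + g)))
    × (∃[ n ] ∃[ m ] ∃[ g ] (4 ≤ m × m ≤ n × g ≤ n / 2 ∸ 1
             × IsTg (K n □ K m) g ((g + 1) * (m ∸ 1) + n ∸ 1)))
corollary6p3 = tᵍ-bounds
             , (4 , 4 , 0 , ≤-refl , ≤-refl , z≤n , t⁰[K₄□K₄]≡6)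
             , (4 , 4 , 0 , ≤-refl , ≤-refl , z≤n , t⁰[K₄□K₄]≡6)
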